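{- Let $k\in\mathbb{N}$. If $k\ge 2$, then every $2$-dimensional grid is equitably $k$-list arborable.
   Context: $P_n$ denotes the path on $n$ vertices and $\square$ the Cartesian product. A $2$-dimensional grid is $P_{n_1}\square P_{n_2}$ with $n_1,n_2\ge 2$. A $k$-uniform list assignment $L$ for $G$ assigns to each vertex $v$ a set $L(v)$ of exactly $k$ colours; an $L$-colouring is a map $c$ with $c(v)\in L(v)$; it is equitable if every colour class has at most $\lceil |V(G)|/k\rceil$ vertices. $G$ is equitably $k$-list arborable if for every $k$-uniform list assignment $L$ there is an equitable $L$-colouring of $G$ in which every colour class induces an acyclic subgraph. -}

module Defs where

open import Data.Nat using (ℕ; zero; suc; _+_; _*_; _≤_; _/_)
open import Data.Nat.Properties using (_≟_)
open import Data.Fin using (Fin; toℕ)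

open import Data.List using (List; []; _∷_; _++_; [_]; length; filter; cartesianProduct; allFin)
open import Data.List.Relation.Unary.Linked using (Linked)
open import Data.List.Relation.Unary.Unique.Propositional using (Unique)
open import Data.List.Membership.Propositional using (_∈_)
open import Data.Product using (_×_; _,_; Σ; proj₁; proj₂)
open import Data.Sum using (_⊎_)
open import Relation.Binary.PropositionalEquality using (_≡_)
open import Relation.Nullary using (¬_)

GridV : ℕ → ℕ → Set
GridV n₁ n₂ = Fin n₁ × Fin n₂

PathAdj : ∀ {n} → Fin n → Fin n → Set
PathAdj i j = (suc (toℕ i) ≡ toℕ j) ⊎ (suc (toℕ j) ≡ toℕ i)

GridAdj : ∀ {n₁ n₂} → GridV n₁ n₂ → GridV n₁ n₂ → Set
GridAdj (i , j) (i' , j') = ((i ≡ i') × PathAdj j j') ⊎ (PathAdj i i' × (j ≡ j'))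

gridVertices : (n₁ n₂ : ℕ) → List (GridV n₁ n₂)
gridVertices n₁ n₂ = cartesianProduct (allFin n₁) (allFin n₂)

record Cycle {V : Set} (Adj : V → V → Set) : Set where
  field
    start    : V
    rest     : List V
    long     : 2 ≤ length rest
    distinct : Unique (start ∷ rest)
    closed   : Linked Adj (start ∷ rest ++ [ start ])

CycleIn : {V : Set} (Adj : V → V → Set) (S : V → Set) → Set
CycleIn {V} Adj S = Σ (Cycle Adj) λ C →
  S (Cycle.start C) × ((v : V) → v ∈ Cycle.rest C → S v)

InducesAcyclic : {V : Set} (Adj : V → V → Set) (S : V → Set) → Set
InducesAcyclic Adj S = ¬ CycleIn Adj S

UniformListAssignment : (V : Set) → ℕ → Set
UniformListAssignment V k =
  Σ (V → List ℕ) λ L → (v : V) → (length (L v) ≡ k) × Unique (L v)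

⌈_/_⌉ : ℕ → ℕ → ℕ
⌈ n / zero ⌉ = zero
⌈ n / suc k ⌉ = (n + k) / suc k

classSize : ∀ {n₁ n₂} → (GridV n₁ n₂ → ℕ) → ℕ → ℕ
classSize {n₁} {n₂} c a = length (filter (λ v → c v ≟ a) (gridVertices n₁ n₂))

GridEquitablyListArborable : ℕ → ℕ → ℕ → Set
GridEquitablyListArborable n₁ n₂ k =
  (L : UniformListAssignment (GridV n₁ n₂) k) →
  Σ (GridV n₁ n₂ → ℕ) λ c →
    ((v : GridV n₁ n₂) → c v ∈ proj₁ L v) ×
    ((a : ℕ) → classSize c a ≤ ⌈ n₁ * n₂ / k ⌉) ×
    ((a : ℕ) → InducesAcyclic (GridAdj {n₁} {n₂}) (λ v → c v ≡ a))

module Submission where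

-- List the N = n₁ n₂ vertices in row-major order and cut this
-- sequence into ⌈N/k⌉ consecutive blocks of (at most) k vertices.  Inside a
-- block, colour greedily with pairwise distinct colours; the first vertex of
-- a block also avoids the last colour of the previous block.  Each step has
-- fewer than k forbidden colours, so a k-list always leaves a choice.  Then
--   * every colour is used at most once per block, hence at most ⌈N/k⌉ times;
--   * consecutive vertices of the sequence get different colours, so in
--     particular no horizontal grid edge is monochromatic.
-- A colour class therefore only spans vertical edges.  A graph whose edges
-- can be oriented by an injective and functional relation compatible with a
-- preorder (here: "one row further down, same column") has no cycles, since
-- a cycle could never turn back; so every colour class is acyclic.

open import Defs
open import Data.Nat using (ℕ; zero; suc; _+_; _*_; _∸_; _≤_; _<_; _/_; _%_; z≤n; s≤s)
open import Data.Nat.Properties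
open import Data.Nat.DivMod using (m≡m%n+[m/n]*n; m%n<n)
open import Data.Fin using (Fin; toℕ) renaming (zero to fzero; suc to fsuc)
open import Data.Fin.Properties using (toℕ-injective) renaming (_≟_ to _≟ᶠ_)
open import Data.List using (List; []; _∷_; _++_; [_]; length; filter; map; take; drop; tabulate; cartesianProduct; allFin)
open import Data.List.Properties using (length-++; length-map; length-take; length-drop; length-tabulate; take++drop≡id; filter-++; filter-notAll; filter-accept; filter-reject; map-cong-local)
open import Data.List.Relation.Unary.Linked as Linked using (Linked; []; [-]; _∷_)
import Data.List.Relation.Unary.Linked.Properties as Linkedₚ
open import Data.List.Relation.Unary.Unique.Propositional using (Unique)
import Data.List.Relation.Unary.Unique.Propositional.Properties as Uniqueₚ
open import Data.List.Relation.Unary.AllPairs using ([]; _∷_)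
open import Data.List.Relation.Unary.All as All using (All; []; _∷_)
open import Data.List.Relation.Unary.All.Properties using (all-filter; ¬Any⇒All¬) renaming (take⁺ to All-take⁺; drop⁺ to All-drop⁺; map⁺ to All-map⁺; ++⁺ to All-++⁺)
import Data.List.Relation.Unary.Any as Any
open import Data.List.Relation.Unary.Any using (here; there)
open import Data.List.Relation.Binary.Pointwise as Pointwise using (Pointwise; []; _∷_; Pointwise-length)
open import Data.List.Membership.Propositional using (_∈_; _∉_; find)
open import Data.List.Membership.Propositional.Properties using (∈-filter⁺; ∈-allFin; ∈-cartesianProduct⁺)
open import Data.List.Membership.DecPropositional _≟_ using (_∈?_)
open import Data.Product using (_×_; _,_; Σ; proj₁; proj₂)
open import Data.Product.Properties using (≡-dec)
open import Data.Sum using (_⊎_; inj₁; inj₂; swap)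
open import Data.Empty using (⊥; ⊥-elim)
open import Function using (_∘_; flip)
open import Relation.Binary.Definitions using (DecidableEquality)
open import Relation.Binary.PropositionalEquality using (_≡_; _≢_; refl; sym; trans; cong; cong₂; subst; module ≡-Reasoning)
open import Relation.Nullary using (¬_; yes; no; ¬?)
open import Relation.Nullary.Decidable using (decidable-stable)

count : ℕ → List ℕ → ℕ
count a xs = length (filter (_≟ a) xs)

count-++ : ∀ a xs ys → count a (xs ++ ys) ≡ count a xs + count a ys
count-++ a xs ys = trans (cong length (filter-++ (_≟ a) xs ys)) (length-++ (filter (_≟ a) xs))

-- A duplicate-free list contains each colour at most once: its a-entries
-- form a duplicate-free list of copies of a.
count-unique : ∀ a {xs} → Unique xs → count a xs ≤ 1
count-unique a {xs} u = constant-unique (all-filter (_≟ a) xs) (Uniqueₚ.filter⁺ (_≟ a) u)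
  where
  constant-unique : ∀ {ys} → All (_≡ a) ys → Unique ys → length ys ≤ 1
  constant-unique []                  _               = z≤n
  constant-unique (_ ∷ [])            _               = s≤s z≤n
  constant-unique (y≡a ∷ z≡a ∷ _) ((y≢z ∷ _) ∷ _) = ⊥-elim (y≢z (trans y≡a (sym z≡a)))

count-map : ∀ {A : Set} (f : A → ℕ) a us →
  length (filter (λ u → f u ≟ a) us) ≡ count a (map f us)
count-map f a [] = refl
count-map f a (u ∷ us) with f u ≟ a
... | yes fu≡a = begin
  length (filter (λ v → f v ≟ a) (u ∷ us))      ≡⟨ cong length (filter-accept (λ v → f v ≟ a) fu≡a) ⟩
  suc (length (filter (λ v → f v ≟ a) us))      ≡⟨ cong suc (count-map f a us) ⟩
  suc (count a (map f us))                       ≡⟨ cong length (filter-accept (_≟ a) fu≡a) ⟨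
  count a (map f (u ∷ us))                       ∎
  where open ≡-Reasoning
... | no fu≢a = begin
  length (filter (λ v → f v ≟ a) (u ∷ us))      ≡⟨ cong length (filter-reject (λ v → f v ≟ a) fu≢a) ⟩
  length (filter (λ v → f v ≟ a) us)            ≡⟨ count-map f a us ⟩
  count a (map f us)                             ≡⟨ cong length (filter-reject (_≟ a) fu≢a) ⟨
  count a (map f (u ∷ us))                       ∎
  where open ≡-Reasoning

-- Pigeonhole: a duplicate-free list whose entries all lie in ys is no
-- longer than ys.  (Remove x from ys and recurse.)
unique-⊆-length : ∀ {xs ys : List ℕ} → Unique xs → All (_∈ ys) xs → length xs ≤ length ys
unique-⊆-length {[]} _ _ = z≤n
unique-⊆-length {x ∷ xs} {ys} (x≢xs ∷ u) (x∈ys ∷ xs⊆ys) = begin-strict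
    length xs                 ≤⟨ unique-⊆-length u (All.zipWith inOthers (x≢xs , xs⊆ys)) ⟩
    length (filter ≢x? ys)    <⟨ filter-notAll ≢x? ys (Any.map (λ x≡y y≢x → y≢x (sym x≡y)) x∈ys) ⟩
    length ys                 ∎
  where
  open ≤-Reasoning
  ≢x? = λ (y : ℕ) → ¬? (y ≟ x)
  inOthers : ∀ {y} → x ≢ y × y ∈ ys → y ∈ filter ≢x? ys
  inOthers (x≢y , y∈ys) = ∈-filter⁺ ≢x? y∈ys (x≢y ∘ sym)

-- Some colour of L outside F (0 if there is none).
fresh : List ℕ → List ℕ → ℕ
fresh L F with Any.any? (λ y → ¬? (y ∈? F)) L
... | yes y∉F = proj₁ (find y∉F)
... | no _    = 0

fresh-spec : ∀ L F → Unique L → length F < length L → fresh L F ∈ L × fresh L F ∉ F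
fresh-spec L F u F<L with Any.any? (λ y → ¬? (y ∈? F)) L
... | yes y∉F = proj₂ (find y∉F)
... | no none = ⊥-elim (<⇒≱ F<L (unique-⊆-length u L⊆F))
  where
  L⊆F : All (_∈ F) L
  L⊆F = All.map (λ {y} → decidable-stable (y ∈? F)) (¬Any⇒All¬ L none)

KList : ℕ → List ℕ → Set
KList k L = length L ≡ k × Unique L

Picks : List (List ℕ) → List ℕ → Set
Picks = Pointwise (λ L x → x ∈ L)

lastOr : ℕ → List ℕ → ℕ
lastOr p []       = p
lastOr p (x ∷ xs) = lastOr x xs

linked-++ : ∀ {R : ℕ → ℕ → Set} p xs ys →
  Linked R (p ∷ xs) → Linked R (lastOr p xs ∷ ys) → Linked R (p ∷ xs ++ ys)
linked-++ p []       ys _        r-ys = r-ys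
linked-++ p (x ∷ xs) ys (r ∷ rs) r-ys = r ∷ linked-++ x xs ys rs r-ys

-- Colours the next vertex of a block must avoid: those already used in the
-- block or, for the first vertex, the last colour p of the previous block.
forbidden : ℕ → List ℕ → List ℕ
forbidden p []         = [ p ]
forbidden p (u ∷ used) = u ∷ used

forbidden-used : ∀ {y} p used → y ∉ forbidden p used → y ∉ used
forbidden-used p []      _   ()
forbidden-used p (_ ∷ _) y∉f = y∉f

colourBlock : ℕ → List ℕ → List (List ℕ) → List ℕ
colourBlock p used []       = []
colourBlock p used (L ∷ Ls) = x ∷ colourBlock p (x ∷ used) Ls
  where x = fresh L (forbidden p used)

room : ∀ {k} m n → m + suc n ≤ k → m < k × suc m + n ≤ k
room {k} m n fits = ≤-trans (s≤s (m≤m+n m n)) fits′ , fits′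
  where fits′ = subst (_≤ k) (+-suc m n) fits

module BlockColouring (k : ℕ) (2≤k : 2 ≤ k) where

  next-spec : ∀ p used L → length used < k → KList k L →
    let x = fresh L (forbidden p used) in x ∈ L × x ∉ forbidden p used
  next-spec p used L used<k (length≡k , unique) =
    fresh-spec L (forbidden p used) unique (subst (_ <_) (sym length≡k) (forbidden<k used used<k))
    where
    forbidden<k : ∀ used → length used < k → length (forbidden p used) < k
    forbidden<k []      _  = 2≤k
    forbidden<k (_ ∷ _) lt = lt

  colourBlock-picks : ∀ p used Ls → length used + length Ls ≤ k → All (KList k) Ls →
    Picks Ls (colourBlock p used Ls)
  colourBlock-picks p used []       _    []          = []
  colourBlock-picks p used (L ∷ Ls) fits (kL ∷ kLs) =
    proj₁ (next-spec p used L used<k kL) ∷ colourBlock-picks p _ Ls fits′ kLs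
    where
    used<k = proj₁ (room (length used) (length Ls) fits)
    fits′  = proj₂ (room (length used) (length Ls) fits)

  colourBlock-new : ∀ p used Ls → length used + length Ls ≤ k → All (KList k) Ls →
    Unique (colourBlock p used Ls) × All (_∉ used) (colourBlock p used Ls)
  colourBlock-new p used []       _    []          = [] , []
  colourBlock-new p used (L ∷ Ls) fits (kL ∷ kLs) =
    All.map (λ y∉ x≡y → y∉ (here (sym x≡y))) rest-new ∷ rest-unique ,
    forbidden-used p used x∉forbidden ∷ All.map (_∘ there) rest-new
    where
    used<k = proj₁ (room (length used) (length Ls) fits)
    x∉forbidden = proj₂ (next-spec p used L used<k kL)
    rest = colourBlock-new p _ Ls (proj₂ (room (length used) (length Ls) fits)) kLs
    rest-unique = proj₁ rest
    rest-new = proj₂ rest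

  colourBlock-chain : ∀ p Ls → length Ls ≤ k → All (KList k) Ls →
    Linked _≢_ (p ∷ colourBlock p [] Ls)
  colourBlock-chain p []       _    []          = [-]
  colourBlock-chain p (L ∷ Ls) fits (kL ∷ kLs) =
    (λ p≡x → x∉[p] (here (sym p≡x))) ∷ Linkedₚ.AllPairs⇒Linked (proj₁ (colourBlock-new p [] (L ∷ Ls) fits (kL ∷ kLs)))
    where x∉[p] = proj₂ (next-spec p [] L (≤-trans (s≤s z≤n) 2≤k) kL)

  take-fits : ∀ (Ls : List (List ℕ)) → length (take k Ls) ≤ k
  take-fits Ls = subst (_≤ k) (sym (length-take k Ls)) (m⊓n≤m k (length Ls))

  colourSeq : ℕ → ℕ → List (List ℕ) → List ℕ
  colourSeq zero    p Ls = []
  colourSeq (suc b) p Ls = block ++ colourSeq b (lastOr p block) (drop k Ls)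
    where block = colourBlock p [] (take k Ls)

  colourSeq-picks : ∀ b p Ls → length Ls ≤ b * k → All (KList k) Ls → Picks Ls (colourSeq b p Ls)
  colourSeq-picks zero    p []       _   _   = []
  colourSeq-picks (suc b) p Ls       fits kLs =
    subst (λ Ms → Picks Ms (colourSeq (suc b) p Ls)) (take++drop≡id k Ls)
      (Pointwise.++⁺ (colourBlock-picks p [] (take k Ls) (take-fits Ls) (All-take⁺ k kLs))
                     (colourSeq-picks b _ (drop k Ls) drop-fits (All-drop⁺ k kLs)))
    where
    drop-fits : length (drop k Ls) ≤ b * k
    drop-fits = begin
      length (drop k Ls)  ≡⟨ length-drop k Ls ⟩
      length Ls ∸ k       ≤⟨ ∸-monoˡ-≤ k fits ⟩
      k + b * k ∸ k       ≡⟨ m+n∸m≡n k (b * k) ⟩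
      b * k               ∎
      where open ≤-Reasoning

  colourSeq-chain : ∀ b p Ls → All (KList k) Ls → Linked _≢_ (p ∷ colourSeq b p Ls)
  colourSeq-chain zero    p Ls kLs = [-]
  colourSeq-chain (suc b) p Ls kLs =
    linked-++ p block _ (colourBlock-chain p (take k Ls) (take-fits Ls) (All-take⁺ k kLs))
                        (colourSeq-chain b (lastOr p block) (drop k Ls) (All-drop⁺ k kLs))
    where block = colourBlock p [] (take k Ls)

  -- Each colour occurs at most once per block.
  colourSeq-count : ∀ a b p Ls → All (KList k) Ls → count a (colourSeq b p Ls) ≤ b
  colourSeq-count a zero    p Ls kLs = z≤n
  colourSeq-count a (suc b) p Ls kLs = begin
    count a (block ++ rest)        ≡⟨ count-++ a block rest ⟩
    count a block + count a rest   ≤⟨ +-mono-≤ (count-unique a block-unique) (colourSeq-count a b _ (drop k Ls) (All-drop⁺ k kLs)) ⟩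
    1 + b                          ∎
    where
    open ≤-Reasoning
    block = colourBlock p [] (take k Ls)
    rest  = colourSeq b (lastOr p block) (drop k Ls)
    block-unique = proj₁ (colourBlock-new p [] (take k Ls) (take-fits Ls) (All-take⁺ k kLs))

sequence-colouring : ∀ k → 2 ≤ k → ∀ b Ls → length Ls ≤ b * k → All (KList k) Ls →
  Σ (List ℕ) λ cs → Picks Ls cs × Linked _≢_ cs × (∀ a → count a cs ≤ b)
sequence-colouring k 2≤k b Ls fits kLs =
  colourSeq b 0 Ls ,
  colourSeq-picks b 0 Ls fits kLs ,
  Linked.tail (colourSeq-chain b 0 Ls kLs) ,
  λ a → colourSeq-count a b 0 Ls kLs
  where open BlockColouring k 2≤k

module _ {A : Set} (_≟ᴬ_ : DecidableEquality A) where

  assign : List A → List ℕ → A → ℕ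
  assign []       _        v = 0
  assign (_ ∷ _)  []       v = 0
  assign (u ∷ us) (x ∷ xs) v with u ≟ᴬ v
  ... | yes _ = x
  ... | no _  = assign us xs v

  assign-here : ∀ u us x xs → assign (u ∷ us) (x ∷ xs) u ≡ x
  assign-here u us x xs with u ≟ᴬ u
  ... | yes _  = refl
  ... | no u≢u = ⊥-elim (u≢u refl)

  assign-there : ∀ u us x xs {w} → u ≢ w → assign (u ∷ us) (x ∷ xs) w ≡ assign us xs w
  assign-there u us x xs {w} u≢w with u ≟ᴬ w
  ... | yes u≡w = ⊥-elim (u≢w u≡w)
  ... | no _    = refl

  map-assign : ∀ {us} xs → Unique us → length us ≡ length xs → map (assign us xs) us ≡ xs
  map-assign {[]}     []       _              _   = refl
  map-assign {u ∷ us} (x ∷ xs) (u≢us ∷ unique) len =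
    cong₂ _∷_ (assign-here u us x xs)
      (trans (map-cong-local (All.map (assign-there u us x xs) u≢us))
             (map-assign xs unique (suc-injective len)))

picks-at : ∀ {A : Set} (L : A → List ℕ) (c : A → ℕ) {us v} →
  Picks (map L us) (map c us) → v ∈ us → c v ∈ L v
picks-at L c (p ∷ _)  (here refl) = p
picks-at L c (_ ∷ ps) (there v∈us) = picks-at L c ps v∈us

gridVertices-unique : ∀ n₁ n₂ → Unique (gridVertices n₁ n₂)
gridVertices-unique n₁ n₂ = Uniqueₚ.cartesianProduct⁺ (Uniqueₚ.allFin⁺ n₁) (Uniqueₚ.allFin⁺ n₂)

gridVertices-complete : ∀ {n₁ n₂} (v : GridV n₁ n₂) → v ∈ gridVertices n₁ n₂
gridVertices-complete (i , j) = ∈-cartesianProduct⁺ (∈-allFin i) (∈-allFin j)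

length-cartesianProduct : ∀ {A B : Set} (xs : List A) (ys : List B) →
  length (cartesianProduct xs ys) ≡ length xs * length ys
length-cartesianProduct []       ys = refl
length-cartesianProduct (x ∷ xs) ys = begin
  length (map (x ,_) ys ++ cartesianProduct xs ys)        ≡⟨ length-++ (map (x ,_) ys) ⟩
  length (map (x ,_) ys) + length (cartesianProduct xs ys) ≡⟨ cong₂ _+_ (length-map (x ,_) ys) (length-cartesianProduct xs ys) ⟩
  length ys + length xs * length ys                         ∎
  where open ≡-Reasoning

gridVertices-length : ∀ n₁ n₂ → length (gridVertices n₁ n₂) ≡ n₁ * n₂
gridVertices-length n₁ n₂ =
  trans (length-cartesianProduct (allFin n₁) (allFin n₂))
        (cong₂ _*_ (length-tabulate {n = n₁} (λ i → i)) (length-tabulate {n = n₂} (λ j → j)))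

linked-++⁻ˡ : ∀ {A : Set} {R : A → A → Set} xs {ys} → Linked R (xs ++ ys) → Linked R xs
linked-++⁻ˡ []           _        = []
linked-++⁻ˡ (x ∷ [])     _        = [-]
linked-++⁻ˡ (x ∷ y ∷ xs) (r ∷ rs) = r ∷ linked-++⁻ˡ (y ∷ xs) rs

linked-++⁻ʳ : ∀ {A : Set} {R : A → A → Set} xs {ys} → Linked R (xs ++ ys) → Linked R ys
linked-++⁻ʳ []       rs = rs
linked-++⁻ʳ (x ∷ xs) rs = linked-++⁻ʳ xs (Linked.tail rs)

linked-row : ∀ {A B : Set} {R : A × B → A × B → Set} (xs : List A) (ys : List B) {i} →
  i ∈ xs → Linked R (cartesianProduct xs ys) → Linked R (map (i ,_) ys)
linked-row (x ∷ xs) ys (here refl)  rs = linked-++⁻ˡ (map (x ,_) ys) rs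
linked-row (x ∷ xs) ys (there i∈xs) rs = linked-row xs ys i∈xs (linked-++⁻ʳ (map (x ,_) ys) rs)

linked-tabulate : ∀ {A : Set} {R : A → A → Set} {n} (f : Fin n → A) → Linked R (tabulate f) →
  ∀ {j j'} → suc (toℕ j) ≡ toℕ j' → R (f j) (f j')
linked-tabulate {n = suc (suc n)} f (r ∷ _)  {fzero}  {fsuc fzero} _ = r
linked-tabulate {n = suc (suc n)} f (_ ∷ rs) {fsuc j} {fsuc j'}    e = linked-tabulate (f ∘ fsuc) rs (suc-injective e)
linked-tabulate {n = suc (suc n)} f _        {fzero}  {fsuc (fsuc _)} ()
linked-tabulate {n = suc n}       f _        {_}      {fzero}      ()
linked-tabulate {n = suc zero}    f _        {fzero}  {fsuc ()}    _
linked-tabulate {n = suc zero}    f _        {fsuc ()} _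

gridVertices-rows : ∀ {n₁ n₂} {R : GridV n₁ n₂ → GridV n₁ n₂ → Set} →
  Linked R (gridVertices n₁ n₂) → ∀ i {j j'} → suc (toℕ j) ≡ toℕ j' → R (i , j) (i , j')
gridVertices-rows {n₁} {n₂} chain i =
  linked-tabulate (λ j → j) (Linkedₚ.map⁻ (linked-row (allFin n₁) (allFin n₂) (∈-allFin i) chain))

Step : {A : Set} → (A → A → Set) → A → A → Set
Step Up a b = Up a b ⊎ Up b a

module Climbing {A : Set} (Up _≼_ : A → A → Set)
  (≼-refl : ∀ {a} → a ≼ a) (≼-trans : ∀ {a b c} → a ≼ b → b ≼ c → a ≼ c)
  (Up⇒≼ : ∀ {a b} → Up a b → a ≼ b) (Up-irrefl : ∀ {a b} → Up a b → b ≼ a → ⊥)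
  (Up-injective : ∀ {a b c} → Up a b → Up c b → a ≡ c) where

  -- After climbing from a to b, a walk that never returns to the vertex
  -- it came from (guaranteed by distinctness) keeps climbing, so it ends
  -- above a.
  ascent : ∀ a b l t → Up a b → Unique (a ∷ b ∷ l) → Linked (Step Up) (b ∷ l ++ [ t ]) → a ≼ t
  ascent a b []      t ab _ (inj₁ bt ∷ [-]) = ≼-trans (Up⇒≼ ab) (Up⇒≼ bt)
  ascent a b []      t ab _ (inj₂ tb ∷ [-]) = subst (a ≼_) (Up-injective ab tb) ≼-refl
  ascent a b (c ∷ l) t ab (_ ∷ unique)        (inj₁ bc ∷ w) = ≼-trans (Up⇒≼ ab) (ascent b c l t bc unique w)
  ascent a b (c ∷ l) t ab ((_ ∷ a≢c ∷ _) ∷ _) (inj₂ cb ∷ _) = ⊥-elim (a≢c (Up-injective ab cb))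

  -- Hence a cycle cannot leave its start s along an upward edge.
  no-upward-exit : ∀ s x y l → Up s x → Unique (s ∷ x ∷ y ∷ l) →
    Linked (Step Up) (x ∷ y ∷ l ++ [ s ]) → ⊥
  no-upward-exit s x y l sx (_ ∷ unique)            (inj₁ xy ∷ w) = Up-irrefl sx (ascent x y l s xy unique w)
  no-upward-exit s x y l sx ((_ ∷ s≢y ∷ _) ∷ _)     (inj₂ yx ∷ _) = s≢y (Up-injective sx yx)

-- A graph oriented by an injective and functional relation that strictly
-- increases a preorder has no cycles: leaving the start upwards contradicts
-- `Climbing` for Up, leaving it downwards contradicts it for the reverse.
oriented-acyclic : ∀ {A : Set} (Up _≼_ : A → A → Set)
  (≼-refl : ∀ {a} → a ≼ a) (≼-trans : ∀ {a b c} → a ≼ b → b ≼ c → a ≼ c)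
  (Up⇒≼ : ∀ {a b} → Up a b → a ≼ b) (Up-irrefl : ∀ {a b} → Up a b → b ≼ a → ⊥)
  (Up-injective : ∀ {a b c} → Up a b → Up c b → a ≡ c)
  (Up-functional : ∀ {a b c} → Up b a → Up b c → a ≡ c) →
  ¬ Cycle (Step Up)
oriented-acyclic Up _≼_ ≼-refl ≼-trans Up⇒≼ Up-irrefl Up-injective Up-functional
  record { start = s ; rest = x ∷ y ∷ l ; distinct = unique ; closed = inj₁ sx ∷ walk } =
  Climbing.no-upward-exit Up _≼_ ≼-refl ≼-trans Up⇒≼ Up-irrefl Up-injective s x y l sx unique walk
oriented-acyclic Up _≼_ ≼-refl ≼-trans Up⇒≼ Up-irrefl Up-injective Up-functional
  record { start = s ; rest = x ∷ y ∷ l ; distinct = unique ; closed = inj₂ xs ∷ walk } =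
  Climbing.no-upward-exit (flip Up) (flip _≼_) ≼-refl (λ ba cb → ≼-trans cb ba) Up⇒≼ Up-irrefl Up-functional
    s x y l xs unique (Linked.map swap walk)
oriented-acyclic _ _ _ _ _ _ _ _ record { rest = [] ; long = () }
oriented-acyclic _ _ _ _ _ _ _ _ record { rest = _ ∷ [] ; long = s≤s () }

linked-restrict : ∀ {A : Set} {Adj Adj′ : A → A → Set} {S : A → Set} →
  (∀ {u v} → S u → S v → Adj u v → Adj′ u v) → ∀ {xs} → All S xs → Linked Adj xs → Linked Adj′ xs
linked-restrict sub []               []       = []
linked-restrict sub (_ ∷ [])         [-]      = [-]
linked-restrict sub (su ∷ sv ∷ ss)   (r ∷ rs) = sub su sv r ∷ linked-restrict sub (sv ∷ ss) rs

restrict-cycle : ∀ {A : Set} {Adj Adj′ : A → A → Set} {S : A → Set} →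
  (∀ {u v} → S u → S v → Adj u v → Adj′ u v) → CycleIn Adj S → Cycle Adj′
restrict-cycle sub (C , s∈S , rest⊆S) = record
  { start    = Cycle.start C
  ; rest     = Cycle.rest C
  ; long     = Cycle.long C
  ; distinct = Cycle.distinct C
  ; closed   = linked-restrict sub (s∈S ∷ All-++⁺ (All.tabulate (rest⊆S _)) (s∈S ∷ [])) (Cycle.closed C)
  }

module _ {n₁ n₂ : ℕ} where

  Down : GridV n₁ n₂ → GridV n₁ n₂ → Set
  Down (i , j) (i' , j') = suc (toℕ i) ≡ toℕ i' × j ≡ j'

  _≼row_ : GridV n₁ n₂ → GridV n₁ n₂ → Set
  (i , _) ≼row (i' , _) = toℕ i ≤ toℕ i'

  down-injective : ∀ {u v w} → Down u w → Down v w → u ≡ v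
  down-injective {_ , j} {_ , _} {_ , _} (e , refl) (e' , refl) =
    cong (_, j) (toℕ-injective (suc-injective (trans e (sym e'))))

  down-functional : ∀ {u v w} → Down v u → Down v w → u ≡ w
  down-functional {_ , j} {_ , _} {_ , _} (e , refl) (e' , refl) =
    cong (_, j) (toℕ-injective (trans (sym e) e'))

  -- The vertical graph, a disjoint union of paths, has no cycles.
  vertical-acyclic : ¬ Cycle (Step Down)
  vertical-acyclic = oriented-acyclic Down _≼row_ ≤-refl ≤-trans
    (λ (e , _) → subst (_ ≤_) e (n≤1+n _)) (λ (e , _) → <⇒≱ (≤-reflexive e))
    down-injective down-functional

  RowProper : (GridV n₁ n₂ → ℕ) → Set
  RowProper c = ∀ i {j j'} → PathAdj j j' → c (i , j) ≢ c (i , j')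

  -- In a row-proper colouring every colour class spans only vertical edges,
  -- hence is acyclic.
  rowProper-acyclic : ∀ c → RowProper c → ∀ a → InducesAcyclic (GridAdj {n₁} {n₂}) (λ v → c v ≡ a)
  rowProper-acyclic c proper a = vertical-acyclic ∘ restrict-cycle vertical
    where
    vertical : ∀ {u v} → c u ≡ a → c v ≡ a → GridAdj u v → Step Down u v
    vertical {i , _} cu cv (inj₁ (refl , horizontal)) = ⊥-elim (proper i horizontal (trans cu (sym cv)))
    vertical _ _ (inj₂ (inj₁ e , refl)) = inj₁ (e , refl)
    vertical _ _ (inj₂ (inj₂ e , refl)) = inj₂ (e , refl)

grid-colouring : ∀ {n₁ n₂} (L : GridV n₁ n₂ → List ℕ) (cs : List ℕ) →
  Picks (map L (gridVertices n₁ n₂)) cs → Linked _≢_ cs →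
  Σ (GridV n₁ n₂ → ℕ) λ c → (∀ v → c v ∈ L v) × (∀ a → classSize c a ≡ count a cs) × RowProper c
grid-colouring {n₁} {n₂} L cs picks chain = c , c∈L , classSize≡count , proper
  where
  vs = gridVertices n₁ n₂
  c : GridV n₁ n₂ → ℕ
  c = assign (≡-dec _≟ᶠ_ _≟ᶠ_) vs cs
  c-tabulates : map c vs ≡ cs
  c-tabulates = map-assign (≡-dec _≟ᶠ_ _≟ᶠ_) cs (gridVertices-unique n₁ n₂)
                  (trans (sym (length-map L vs)) (Pointwise-length picks))
  c∈L : ∀ v → c v ∈ L v
  c∈L v = picks-at L c (subst (Picks (map L vs)) (sym c-tabulates) picks) (gridVertices-complete v)
  classSize≡count : ∀ a → classSize c a ≡ count a cs
  classSize≡count a = trans (count-map c a vs) (cong (count a) c-tabulates)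
  consecutive : ∀ i {j j'} → suc (toℕ j) ≡ toℕ j' → c (i , j) ≢ c (i , j')
  consecutive = gridVertices-rows (Linkedₚ.map⁻ (subst (Linked _≢_) (sym c-tabulates) chain))
  proper : RowProper c
  proper i (inj₁ e) = consecutive i e
  proper i (inj₂ e) = consecutive i e ∘ sym

ceil-cover : ∀ N k' → N ≤ ⌈ N / suc k' ⌉ * suc k'
ceil-cover N k' = +-cancelʳ-≤ k' N (q * k) (begin
    N + k'       ≡⟨ m≡m%n+[m/n]*n (N + k') k ⟩
    r + q * k    ≤⟨ +-monoˡ-≤ (q * k) (≤-pred (m%n<n (N + k') k)) ⟩
    k' + q * k   ≡⟨ +-comm k' (q * k) ⟩
    q * k + k'   ∎)
  where
  open ≤-Reasoning
  k = suc k'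
  q = (N + k') / k
  r = (N + k') % k

grid-blocks : ∀ {n₁ n₂} (L : GridV n₁ n₂ → List ℕ) k' →
  length (map L (gridVertices n₁ n₂)) ≤ ⌈ n₁ * n₂ / suc k' ⌉ * suc k'
grid-blocks {n₁} {n₂} L k' =
  subst (_≤ ⌈ n₁ * n₂ / suc k' ⌉ * suc k') (sym (trans (length-map L (gridVertices n₁ n₂)) (gridVertices-length n₁ n₂)))
    (ceil-cover (n₁ * n₂) k')

theorem6 : (k : ℕ) → 2 ≤ k → (n₁ n₂ : ℕ) → 2 ≤ n₁ → 2 ≤ n₂ →
    GridEquitablyListArborable n₁ n₂ k
theorem6 k@(suc k') 2≤k n₁ n₂ _ _ (L , L-uniform)
  with sequence-colouring k 2≤k ⌈ n₁ * n₂ / k ⌉ (map L (gridVertices n₁ n₂))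
         (grid-blocks L k') (All-map⁺ (All.universal L-uniform _))
... | cs , picks , chain , counts with grid-colouring L cs picks chain
... | c , c∈L , classSize≡count , proper =
  c , c∈L , (λ a → subst (_≤ _) (sym (classSize≡count a)) (counts a)) , rowProper-acyclic c proper
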